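{- If $(C_1,F_1)$ and $(C_2,F_2)$ are antlers in an undirected multigraph $G$, then $(C_1\setminus(C_2\cup F_2),\,F_1\setminus(C_2\cup F_2))$ is an antler in $G-(C_2\cup F_2)$.
   Context: Graphs are undirected multigraphs, possibly with self-loops and parallel edges (these count as cycles). A feedback vertex set (FVS) of $G$ is a set $X\subseteq V(G)$ with $G-X$ acyclic; $\mathrm{fvs}(G)$ is its minimum size. For disjoint vertex sets $X,Y$, $e(X,Y)$ is the number of edges between them. A feedback vertex cut (FVC) in $G$ is a pair of disjoint sets $C,F\subseteq V(G)$ such that $G[F]$ is a forest and every tree $T$ of $G[F]$ satisfies $e(V(T),V(G)\setminus(C\cup F))\le1$. An antler in $G$ is an FVC $(C,F)$ with $|C|\le\mathrm{fvs}(G[C\cup F])$. -}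

module Defs where

open import Data.Nat using (ℕ; zero; suc; _≤_)
open import Data.Bool using (Bool; true; false; _∧_; _∨_)
open import Data.Fin using (Fin; zero; suc; inject₁; fromℕ)
open import Data.Fin.Subset using (Subset; _∈_; _⊆_; _∪_; _─_; ∣_∣; Nonempty; Empty; _∩_)
open import Data.Fin.Subset.Properties using (_∈?_)
open import Data.Vec using (tabulate)
open import Data.Product using (Σ; ∃; ∃-syntax; _×_; _,_)
open import Data.Sum using (_⊎_)
open import Relation.Nullary using (¬_; does)
open import Relation.Binary.PropositionalEquality using (_≡_)
open import Function.Definitions using (Injective)

-- Self-loops (ends i = (v , v))
-- and parallel edges (distinct indices with the same endpoints) are allowed.
record Multigraph : Set where
  field
    n    : ℕ
    m    : ℕ
    ends : Fin m → Fin n × Fin n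

open Multigraph public

VSet : Multigraph → Set
VSet G = Subset (n G)

Joins : (G : Multigraph) → Fin (m G) → Fin (n G) → Fin (n G) → Set
Joins G e u v = ends G e ≡ (u , v) ⊎ ends G e ≡ (v , u)

-- A cycle in the induced subgraph G[U]: k+1 pairwise distinct vertices of U,
-- v₀ … v_k, and k+1 pairwise distinct edges, edge i joining v_i and v_{i+1}
-- (indices mod k+1).  k = 0 gives a self-loop, k = 1 two parallel edges.
record Cycle (G : Multigraph) (U : VSet G) : Set where
  field
    k      : ℕ
    vs     : Fin (suc k) → Fin (n G)
    es     : Fin (suc k) → Fin (m G)
    vs-inj : Injective _≡_ _≡_ vs
    es-inj : Injective _≡_ _≡_ es
    vs-in  : ∀ i → vs i ∈ U
    step   : ∀ (i : Fin k) → Joins G (es (inject₁ i)) (vs (inject₁ i)) (vs (suc i))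
    close  : Joins G (es (fromℕ k)) (vs (fromℕ k)) (vs zero)

Acyclic : (G : Multigraph) → VSet G → Set
Acyclic G U = ¬ Cycle G U

IsFVS : (G : Multigraph) → VSet G → VSet G → Set
IsFVS G U X = X ⊆ U × Acyclic G (U ─ X)

FvsIs : (G : Multigraph) → VSet G → ℕ → Set
FvsIs G U k =
  (∃[ X ] (IsFVS G U X × ∣ X ∣ ≡ k)) × (∀ X → IsFVS G U X → k ≤ ∣ X ∣)

crossing : (G : Multigraph) → VSet G → VSet G → Fin (m G) → Bool
crossing G X Y i with ends G i
... | (u , v) = (does (u ∈? X) ∧ does (v ∈? Y)) ∨ (does (v ∈? X) ∧ does (u ∈? Y))

e : (G : Multigraph) → VSet G → VSet G → ℕ
e G X Y = ∣ tabulate (crossing G X Y) ∣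

data Walk (G : Multigraph) (T : VSet G) : Fin (n G) → Fin (n G) → Set where
  here : ∀ {u} → u ∈ T → Walk G T u u
  step : ∀ {u w v} (i : Fin (m G)) → u ∈ T → Joins G i u w → Walk G T w v → Walk G T u v

Connected : (G : Multigraph) → VSet G → Set
Connected G T = ∀ u v → u ∈ T → v ∈ T → Walk G T u v

-- T is (the vertex set of) a tree of the forest G[F], i.e. a connected
-- component of G[F]: nonempty, contained in F, connected, and with no edge
-- to the rest of F.
IsTreeOf : (G : Multigraph) → VSet G → VSet G → Set
IsTreeOf G F T = Nonempty T × T ⊆ F × Connected G T × e G T (F ─ T) ≡ 0

Disjoint : ∀ {k} → Subset k → Subset k → Set
Disjoint C F = Empty (C ∩ F)

FVC : (G : Multigraph) → VSet G → VSet G → VSet G → Set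
FVC G U C F =
  C ⊆ U × F ⊆ U × Disjoint C F × Acyclic G F ×
  (∀ T → IsTreeOf G F T → e G T (U ─ (C ∪ F)) ≤ 1)

Antler : (G : Multigraph) → VSet G → VSet G → VSet G → Set
Antler G U C F = FVC G U C F × ∃[ k ] (FvsIs G (C ∪ F) k × ∣ C ∣ ≤ k)

-- The key fact is that for a feedback vertex cut (C , F) of G, every cycle of G
-- avoiding C also avoids F: a cycle through a tree T of G[F] but not inside T
-- leaves T at least twice, and since the cycle avoids C and T is a component
-- of G[F], both exits lead to V ∖ (C ∪ F), contradicting e(T , V ∖ (C ∪ F)) ≤ 1.
--
-- Write X = C₂ ∪ F₂, C = C₁ ∖ X and F = F₁ ∖ X.  Restricting to G - X keeps
-- (C , F) a feedback vertex cut, since every tree of G[F] lies in a tree of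
-- G[F₁].  For minimality, the key fact shows that (C₂ ∖ F₁) ∪ (C₁ ∩ F₂) is a
-- feedback vertex set of G[C₂ ∪ F₂], so |C₂ ∩ F₁| ≤ |C₁ ∩ F₂| as C₂ is a
-- minimum one; and that for any feedback vertex set S of G[C ∪ F] the set
-- S ∪ (C₁ ∩ C₂) ∪ (C₂ ∩ F₁) is one of G[C₁ ∪ F₁].  Hence
-- |C₁| ≤ |S| + |C₁ ∩ C₂| + |C₁ ∩ F₂|, while |C₁| = |C| + |C₁ ∩ C₂| + |C₁ ∩ F₂|.
module Submission where

open import Data.Bool using (Bool; T)
open import Data.Bool.Properties using (T-≡; T-∧; T-∨)
open import Data.Empty using (⊥-elim)
open import Data.Fin using (Fin; zero; suc; inject₁; fromℕ; _≟_)
open import Data.Fin.Properties using (any?; ¬∀⟶∃¬)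
open import Data.Fin.Subset
  using (Subset; _∈_; _∉_; _⊆_; _⊂_; _∪_; _∩_; _─_; ⊤; ⁅_⁆; ∣_∣; Empty; inside; outside)
open import Data.Fin.Subset.Properties
  using (_∈?_; ∈⊤; ⊆⊤; p⊆p∪q; q⊆p∪q; x∈p∪q⁺; x∈p∪q⁻; x∈p∩q⁺; x∈p∩q⁻;
         p─q⊆p; x∈p∧x∉q⇒x∈p─q; p─q─r≡p─q∪r; p⊆q⇒∣p∣≤∣q∣; p⊂q⇒∣p∣<∣q∣; ∣p∣≤n;
         ∣p∣≤∣x∷p∣; x∈⁅x⁆; x∈⁅y⁆⇒x≡y; x≢y⇒x∉⁅y⁆; ∣⁅x⁆∣≡1; Empty-unique; ∣⊥∣≡0)
open import Data.Nat using (ℕ; zero; suc; _+_; _≤_; _<_; z≤n; s≤s)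
open import Data.Nat.Properties
  using (≤-refl; ≤-reflexive; ≤-trans; <-irrefl; +-suc; +-comm; +-assoc; +-monoʳ-≤; +-cancelˡ-≤;
         +-cancelʳ-≤; module ≤-Reasoning)
open import Data.Product using (∃; ∃₂; _×_; _,_; proj₁; proj₂)
open import Data.Product.Properties using (≡-dec)
open import Data.Sum using (_⊎_; inj₁; inj₂; [_,_])
open import Data.Vec using ([]; _∷_; tabulate; here; there)
open import Data.Vec.Properties using (lookup⇒[]=; []=⇒lookup; lookup∘tabulate)
open import Function using (_∘_)
open import Function.Bundles using (Equivalence)
open import Relation.Nullary using (¬_; Dec; yes; no; does)
open import Relation.Nullary.Decidable
  using (dec-true; decidable-stable; ¬?; _×-dec_; _⊎-dec_)
open import Relation.Unary using (Decidable)
open import Relation.Binary.PropositionalEquality using (_≡_; _≢_; refl; sym; trans; cong; subst)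

open import Defs

open Equivalence using (to; from)

private
  variable
    d : ℕ

x∈p─q⇒x∉q : ∀ {x : Fin d} (p q : Subset d) → x ∈ p ─ q → x ∉ q
x∈p─q⇒x∉q (_ ∷ p) (outside ∷ q) here         ()
x∈p─q⇒x∉q (_ ∷ p) (_ ∷ q)       (there x∈p─q) (there x∈q) = x∈p─q⇒x∉q p q x∈p─q x∈q

─-monoˡ : ∀ {p q r : Subset d} → p ⊆ q → p ─ r ⊆ q ─ r
─-monoˡ {p = p} {r = r} p⊆q x∈ = x∈p∧x∉q⇒x∈p─q (p⊆q (p─q⊆p p r x∈)) (x∈p─q⇒x∉q p r x∈)

p∪q─p⊆q : ∀ (p q : Subset d) → (p ∪ q) ─ p ⊆ q
p∪q─p⊆q p q x∈ =
  [ ⊥-elim ∘ x∈p─q⇒x∉q (p ∪ q) p x∈ , (λ x∈q → x∈q) ] (x∈p∪q⁻ p q (p─q⊆p (p ∪ q) p x∈))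

x∈p∪q─r : ∀ {x : Fin d} (p q r : Subset d) → x ∈ p ∪ q → x ∉ r → x ∈ (p ─ r) ∪ (q ─ r)
x∈p∪q─r p q r x∈ x∉r = x∈p∪q⁺ (Data.Sum.map (λ x∈p → x∈p∧x∉q⇒x∈p─q x∈p x∉r)
                                           (λ x∈q → x∈p∧x∉q⇒x∈p─q x∈q x∉r) (x∈p∪q⁻ p q x∈))

p─r∪q─r⊆p∪q : ∀ (p q r : Subset d) → (p ─ r) ∪ (q ─ r) ⊆ p ∪ q
p─r∪q─r⊆p∪q p q r x∈ = x∈p∪q⁺ (Data.Sum.map (p─q⊆p p r) (p─q⊆p q r) (x∈p∪q⁻ (p ─ r) (q ─ r) x∈))

∣p∪q∣≤∣p∣+∣q∣ : ∀ (p q : Subset d) → ∣ p ∪ q ∣ ≤ ∣ p ∣ + ∣ q ∣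
∣p∪q∣≤∣p∣+∣q∣ [] [] = z≤n
∣p∪q∣≤∣p∣+∣q∣ (inside ∷ p) (b ∷ q) =
  s≤s (≤-trans (∣p∪q∣≤∣p∣+∣q∣ p q) (+-monoʳ-≤ ∣ p ∣ (∣p∣≤∣x∷p∣ b q)))
∣p∪q∣≤∣p∣+∣q∣ (outside ∷ p) (inside ∷ q) =
  ≤-trans (s≤s (∣p∪q∣≤∣p∣+∣q∣ p q)) (≤-reflexive (sym (+-suc ∣ p ∣ ∣ q ∣)))
∣p∪q∣≤∣p∣+∣q∣ (outside ∷ p) (outside ∷ q) = ∣p∪q∣≤∣p∣+∣q∣ p q

∣p∣≡∣p─q∣+∣p∩q∣ : ∀ (p q : Subset d) → ∣ p ∣ ≡ ∣ p ─ q ∣ + ∣ p ∩ q ∣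
∣p∣≡∣p─q∣+∣p∩q∣ [] [] = refl
∣p∣≡∣p─q∣+∣p∩q∣ (inside ∷ p) (inside ∷ q) =
  trans (cong suc (∣p∣≡∣p─q∣+∣p∩q∣ p q)) (sym (+-suc ∣ p ─ q ∣ ∣ p ∩ q ∣))
∣p∣≡∣p─q∣+∣p∩q∣ (inside ∷ p) (outside ∷ q) = cong suc (∣p∣≡∣p─q∣+∣p∩q∣ p q)
∣p∣≡∣p─q∣+∣p∩q∣ (outside ∷ p) (inside ∷ q) = ∣p∣≡∣p─q∣+∣p∩q∣ p q
∣p∣≡∣p─q∣+∣p∩q∣ (outside ∷ p) (outside ∷ q) = ∣p∣≡∣p─q∣+∣p∩q∣ p q

Empty⇒∣p∣≡0 : ∀ {p : Subset d} → Empty p → ∣ p ∣ ≡ 0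
Empty⇒∣p∣≡0 {d = d} empty = trans (cong ∣_∣ (Empty-unique empty)) (∣⊥∣≡0 d)

x≢y⇒2≤∣p∣ : ∀ {x y : Fin d} {p : Subset d} → x ∈ p → y ∈ p → x ≢ y → 2 ≤ ∣ p ∣
x≢y⇒2≤∣p∣ {x = x} {y = y} {p = p} x∈p y∈p x≢y =
  subst (_< ∣ p ∣) (∣⁅x⁆∣≡1 x) (p⊂q⇒∣p∣<∣q∣ (⁅x⁆⊆p , y , y∈p , x≢y⇒x∉⁅y⁆ (x≢y ∘ sym)))
  where
  ⁅x⁆⊆p : ⁅ x ⁆ ⊆ p
  ⁅x⁆⊆p z∈⁅x⁆ with refl ← x∈⁅y⁆⇒x≡y x z∈⁅x⁆ = x∈p

T-does⁺ : ∀ {A : Set} (a? : Dec A) → A → T (does a?)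
T-does⁺ a? a = T-≡ .from (dec-true a? a)

T-does⁻ : ∀ {A : Set} (a? : Dec A) → T (does a?) → A
T-does⁻ (yes a) _  = a
T-does⁻ (no _)  ()

x∈tabulate⁺ : ∀ {f : Fin d → Bool} {x} → T (f x) → x ∈ tabulate f
x∈tabulate⁺ {f = f} {x = x} fx = lookup⇒[]= x _ (trans (lookup∘tabulate f x) (T-≡ .to fx))

x∈tabulate⁻ : ∀ {f : Fin d → Bool} {x} → x ∈ tabulate f → T (f x)
x∈tabulate⁻ {f = f} {x = x} x∈ = T-≡ .from (trans (sym (lookup∘tabulate f x)) ([]=⇒lookup x∈))

data Next (k : ℕ) : Fin (suc k) → Fin (suc k) → Set where
  inner : (i : Fin k) → Next k (inject₁ i) (suc i)
  wrap  : Next k (fromℕ k) zero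

module _ {k : ℕ} where

  Exit : (Fin (suc k) → Set) → Set
  Exit P = ∃₂ λ a b → Next k a b × P a × ¬ P b

  Next-invariant : ∀ {Q : Fin (suc k) → Set} → (∀ {a b} → Next k a b → Q a → Q b) →
                   ∀ {a b} → Q a → Q b
  Next-invariant {Q} preserved {a} {b} qa =
    from-zero k Q (preserved ∘ inner) (preserved wrap (to-last k Q (preserved ∘ inner) a qa)) b
    where
    from-zero : ∀ j (Q : Fin (suc j) → Set) → (∀ i → Q (inject₁ i) → Q (suc i)) →
                Q zero → ∀ b → Q b
    from-zero j       Q advance q₀ zero    = q₀
    from-zero (suc j) Q advance q₀ (suc b) =
      advance b (from-zero j (Q ∘ inject₁) (advance ∘ inject₁) q₀ b)

    to-last : ∀ j (Q : Fin (suc j) → Set) → (∀ i → Q (inject₁ i) → Q (suc i)) →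
              ∀ a → Q a → Q (fromℕ j)
    to-last zero    Q advance zero    qa = qa
    to-last (suc j) Q advance zero    qa =
      to-last j (Q ∘ suc) (advance ∘ suc) zero (advance zero qa)
    to-last (suc j) Q advance (suc a) qa = to-last j (Q ∘ suc) (advance ∘ suc) a qa

  exit-or-invariant : ∀ {P : Fin (suc k) → Set} → Decidable P →
                      Exit P ⊎ (∀ {a b} → Next k a b → P a → P b)
  exit-or-invariant {P} P? with any? (λ i → P? (inject₁ i) ×-dec ¬? (P? (suc i)))
                              | P? (fromℕ k) ×-dec ¬? (P? zero)
  ... | yes (i , pa , ¬pb) | _            = inj₁ (_ , _ , inner i , pa , ¬pb)
  ... | no _               | yes (pa , ¬pb) = inj₁ (_ , _ , wrap , pa , ¬pb)
  ... | no no-inner        | no no-wrap   = inj₂ preserved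
    where
    preserved : ∀ {a b} → Next k a b → P a → P b
    preserved (inner i) pa = decidable-stable (P? (suc i)) λ ¬pb → no-inner (i , pa , ¬pb)
    preserved wrap      pa = decidable-stable (P? zero) λ ¬pb → no-wrap (pa , ¬pb)

  exit : ∀ {P : Fin (suc k) → Set} → Decidable P → ∀ {a b} → P a → ¬ P b → Exit P
  exit P? pa ¬pb with exit-or-invariant P?
  ... | inj₁ ex        = ex
  ... | inj₂ preserved = ⊥-elim (¬pb (Next-invariant preserved pa))

module _ (G : Multigraph) where

  private
    V : Set
    V = Fin (n G)

  joins-sym : ∀ {i u v} → Joins G i u v → Joins G i v u
  joins-sym (inj₁ p) = inj₂ p
  joins-sym (inj₂ p) = inj₁ p

  joins? : ∀ i u v → Dec (Joins G i u v)
  joins? i u v = ≡-dec _≟_ _≟_ (ends G i) (u , v) ⊎-dec ≡-dec _≟_ _≟_ (ends G i) (v , u)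

  Crosses : VSet G → VSet G → Fin (m G) → Set
  Crosses X Y i = ∃₂ λ u v → Joins G i u v × u ∈ X × v ∈ Y

  crossing⁺ : ∀ {X Y i} → Crosses X Y i → T (crossing G X Y i)
  crossing⁺ {X} {Y} (u , v , inj₁ eq , u∈X , v∈Y) rewrite eq =
    T-∨ .from (inj₁ (T-∧ .from (T-does⁺ (u ∈? X) u∈X , T-does⁺ (v ∈? Y) v∈Y)))
  crossing⁺ {X} {Y} (u , v , inj₂ eq , u∈X , v∈Y) rewrite eq =
    T-∨ .from (inj₂ (T-∧ .from (T-does⁺ (u ∈? X) u∈X , T-does⁺ (v ∈? Y) v∈Y)))

  crossing⁻ : ∀ {X Y} i → T (crossing G X Y i) → Crosses X Y i
  crossing⁻ {X} {Y} i h with ends G i in eq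
  ... | (u , v) with T-∨ .to h
  ...   | inj₁ uv = let (u∈X , v∈Y) = T-∧ .to uv in
                    u , v , inj₁ refl , T-does⁻ (u ∈? X) u∈X , T-does⁻ (v ∈? Y) v∈Y
  ...   | inj₂ vu = let (v∈X , u∈Y) = T-∧ .to vu in
                    v , u , inj₂ refl , T-does⁻ (v ∈? X) v∈X , T-does⁻ (u ∈? Y) u∈Y

  e-mono : ∀ {X Y X′ Y′} → X ⊆ X′ → Y ⊆ Y′ → e G X Y ≤ e G X′ Y′
  e-mono X⊆X′ Y⊆Y′ = p⊆q⇒∣p∣≤∣q∣ λ {i} i∈ →
    let (u , v , J , u∈X , v∈Y) = crossing⁻ i (x∈tabulate⁻ i∈) in
    x∈tabulate⁺ (crossing⁺ (u , v , J , X⊆X′ u∈X , Y⊆Y′ v∈Y))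

  e≡0 : ∀ {X Y} → (∀ {i u v} → Joins G i u v → u ∈ X → v ∉ Y) → e G X Y ≡ 0
  e≡0 no-edge = Empty⇒∣p∣≡0 λ (i , i∈) →
    let (u , v , J , u∈X , v∈Y) = crossing⁻ i (x∈tabulate⁻ i∈) in no-edge J u∈X v∈Y

  2≤e : ∀ {X Y i j} → i ≢ j → Crosses X Y i → Crosses X Y j → 2 ≤ e G X Y
  2≤e i≢j cross-i cross-j =
    x≢y⇒2≤∣p∣ (x∈tabulate⁺ (crossing⁺ cross-i)) (x∈tabulate⁺ (crossing⁺ cross-j)) i≢j

  walk-source : ∀ {T u v} → Walk G T u v → u ∈ T
  walk-source (here u∈T)       = u∈T
  walk-source (step _ u∈T _ _) = u∈T

  walk-mono : ∀ {T T′ u v} → T ⊆ T′ → Walk G T u v → Walk G T′ u v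
  walk-mono T⊆T′ (here u∈T)       = here (T⊆T′ u∈T)
  walk-mono T⊆T′ (step i u∈T J w) = step i (T⊆T′ u∈T) J (walk-mono T⊆T′ w)

  walk-++ : ∀ {T u w v} → Walk G T u w → Walk G T w v → Walk G T u v
  walk-++ (here _)         w′ = w′
  walk-++ (step i u∈T J w) w′ = step i u∈T J (walk-++ w w′)

  walk-snoc : ∀ {T u w v} → Walk G T u w → (i : Fin (m G)) → Joins G i w v → v ∈ T → Walk G T u v
  walk-snoc (here w∈T)          i J v∈T = step i w∈T J (here v∈T)
  walk-snoc (step i′ u∈T J′ w) i J v∈T = step i′ u∈T J′ (walk-snoc w i J v∈T)

  walk-reverse : ∀ {T u v} → Walk G T u v → Walk G T v u
  walk-reverse (here u∈T)       = here u∈T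
  walk-reverse (step i u∈T J w) = walk-snoc (walk-reverse w) i (joins-sym J) u∈T

  Adj : VSet G → V → Set
  Adj R v = ∃₂ λ i u → u ∈ R × Joins G i u v

  adj? : ∀ R v → Dec (Adj R v)
  adj? R v = any? λ i → any? λ u → (u ∈? R) ×-dec joins? i u v

  ClosedIn : VSet G → VSet G → Set
  ClosedIn F R = ∀ {v} → v ∈ F → Adj R v → v ∈ R

  closed-walk : ∀ {F R T a b} → ClosedIn F R → T ⊆ F → Walk G T a b → a ∈ R → b ∈ R
  closed-walk closed T⊆F (here _)       a∈R = a∈R
  closed-walk closed T⊆F (step i _ J w) a∈R =
    closed-walk closed T⊆F w (closed (T⊆F (walk-source w)) (i , _ , a∈R , J))

  -- The tree of the forest G[F] through t, grown breadth-first from t; after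
  -- n G rounds it can no longer grow, so it is closed under adjacency in F.
  module Component (F : VSet G) {t : V} (t∈F : t ∈ F) where

    Expand : VSet G → V → Set
    Expand R v = v ∈ R ⊎ (v ∈ F × Adj R v)

    expand? : ∀ R → Decidable (Expand R)
    expand? R v = (v ∈? R) ⊎-dec ((v ∈? F) ×-dec adj? R v)

    expand : VSet G → VSet G
    expand R = tabulate (does ∘ expand? R)

    ∈expand⁺ : ∀ {R v} → Expand R v → v ∈ expand R
    ∈expand⁺ {R} {v} = x∈tabulate⁺ ∘ T-does⁺ (expand? R v)

    ∈expand⁻ : ∀ {R v} → v ∈ expand R → Expand R v
    ∈expand⁻ {R} {v} = T-does⁻ (expand? R v) ∘ x∈tabulate⁻

    ⊆expand : ∀ {R} → R ⊆ expand R
    ⊆expand = ∈expand⁺ ∘ inj₁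

    expand-closed : ∀ {R} → ClosedIn F R → ClosedIn F (expand R)
    expand-closed closed v∈F (i , u , u∈ , J) with ∈expand⁻ u∈
    ... | inj₁ u∈R         = ⊆expand (closed v∈F (i , u , u∈R , J))
    ... | inj₂ (u∈F , adj) = ⊆expand (closed v∈F (i , u , closed u∈F adj , J))

    closed-or-grows : ∀ R → ClosedIn F R ⊎ R ⊂ expand R
    closed-or-grows R with any? (λ v → (v ∈? F) ×-dec (adj? R v ×-dec ¬? (v ∈? R)))
    ... | yes (v , v∈F , adj , v∉R) = inj₂ (⊆expand , v , ∈expand⁺ (inj₂ (v∈F , adj)) , v∉R)
    ... | no no-new =
      inj₁ λ {v} v∈F adj → decidable-stable (v ∈? R) λ v∉R → no-new (v , v∈F , adj , v∉R)

    ball : ℕ → VSet G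
    ball zero    = ⁅ t ⁆
    ball (suc j) = expand (ball j)

    closed-or-large : ∀ j → ClosedIn F (ball j) ⊎ j < ∣ ball j ∣
    closed-or-large zero = inj₂ (subst (0 <_) (sym (∣⁅x⁆∣≡1 t)) (s≤s z≤n))
    closed-or-large (suc j) with closed-or-large j | closed-or-grows (ball j)
    ... | inj₁ closed | _           = inj₁ (expand-closed closed)
    ... | inj₂ _      | inj₁ closed = inj₁ (expand-closed closed)
    ... | inj₂ large  | inj₂ grows  = inj₂ (≤-trans (s≤s large) (p⊂q⇒∣p∣<∣q∣ grows))

    ball⊆F : ∀ j → ball j ⊆ F
    ball⊆F zero    v∈ with refl ← x∈⁅y⁆⇒x≡y t v∈ = t∈F
    ball⊆F (suc j) v∈ with ∈expand⁻ v∈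
    ... | inj₁ v∈ball   = ball⊆F j v∈ball
    ... | inj₂ (v∈F , _) = v∈F

    ball-walk : ∀ j {v} → v ∈ ball j → Walk G (ball j) t v
    ball-walk zero    v∈ with refl ← x∈⁅y⁆⇒x≡y t v∈ = here v∈
    ball-walk (suc j) v∈ with ∈expand⁻ v∈
    ... | inj₁ v∈ball                 = walk-mono ⊆expand (ball-walk j v∈ball)
    ... | inj₂ (_ , i , _ , u∈ball , J) = walk-snoc (walk-mono ⊆expand (ball-walk j u∈ball)) i J v∈

    component : VSet G
    component = ball (n G)

    t∈component : t ∈ component
    t∈component = t∈ball (n G)
      where
      t∈ball : ∀ j → t ∈ ball j
      t∈ball zero    = x∈⁅x⁆ t
      t∈ball (suc j) = ⊆expand (t∈ball j)

    component⊆F : component ⊆ F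
    component⊆F = ball⊆F (n G)

    component-closed : ClosedIn F component
    component-closed with closed-or-large (n G)
    ... | inj₁ closed = closed
    ... | inj₂ large  = ⊥-elim (<-irrefl refl (≤-trans large (∣p∣≤n component)))

    component-isTree : IsTreeOf G F component
    component-isTree = (t , t∈component) , component⊆F , connected , e≡0 no-edge
      where
      connected : Connected G component
      connected u v u∈ v∈ = walk-++ (walk-reverse (ball-walk (n G) u∈)) (ball-walk (n G) v∈)
      no-edge : ∀ {i u v} → Joins G i u v → u ∈ component → v ∉ F ─ component
      no-edge J u∈ v∈ = x∈p─q⇒x∉q F component v∈
        (component-closed (p─q⊆p F component v∈) (_ , _ , u∈ , J))

  open Cycle using (k; vs; es; vs-in; es-inj)

  cycle-joins : ∀ {U} (c : Cycle G U) {a b} → Next (k c) a b → Joins G (es c a) (vs c a) (vs c b)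
  cycle-joins c (inner i) = Cycle.step c i
  cycle-joins c wrap      = Cycle.close c

  retarget : ∀ {U U′} (c : Cycle G U) → (∀ i → vs c i ∈ U′) → Cycle G U′
  retarget c vs∈U′ = record
    { k = k c ; vs = vs c ; es = es c ; vs-inj = Cycle.vs-inj c ; es-inj = es-inj c
    ; vs-in = vs∈U′ ; step = Cycle.step c ; close = Cycle.close c }

  Acyclic-anti : ∀ {U U′} → U ⊆ U′ → Acyclic G U′ → Acyclic G U
  Acyclic-anti U⊆U′ acyclic c = acyclic (retarget c (U⊆U′ ∘ vs-in c))

  cycle-∉C⇒∉F : ∀ {C F Y} → FVC G ⊤ C F → (c : Cycle G Y) → (∀ i → vs c i ∉ C) → ∀ i → vs c i ∉ F
  cycle-∉C⇒∉F {C} {F} (_ , _ , _ , F-acyclic , trees) c ∉C i vᵢ∈F =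
    <-irrefl refl (≤-trans two-exits (trees component component-isTree))
    where
    open Component F vᵢ∈F

    In : Fin (suc (k c)) → Set
    In a = vs c a ∈ component

    In? : Decidable In
    In? a = vs c a ∈? component

    escapee : ∃ (¬_ ∘ In)
    escapee = ¬∀⟶∃¬ _ In In? λ all-in → F-acyclic (retarget c (component⊆F ∘ all-in))

    beyond : ∀ {a} → ¬ In a → Adj component (vs c a) → vs c a ∈ ⊤ ─ (C ∪ F)
    beyond {a} ¬in adj = x∈p∧x∉q⇒x∈p─q ∈⊤ λ a∈C∪F →
      [ ∉C a , (λ a∈F → ¬in (component-closed a∈F adj)) ] (x∈p∪q⁻ C F a∈C∪F)

    two-exits : 2 ≤ e G component (⊤ ─ (C ∪ F))
    two-exits with exit In? t∈component (proj₂ escapee)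
                 | exit (¬? ∘ In?) (proj₂ escapee) (λ ¬in → ¬in t∈component)
    ... | a , b , a→b , in-a , ¬in-b | a′ , b′ , a′→b′ , ¬in-a′ , ¬¬in-b′ =
      2≤e distinct
        (vs c a , vs c b , J , in-a , beyond ¬in-b (es c a , vs c a , in-a , J))
        (vs c b′ , vs c a′ , joins-sym J′ , in-b′ ,
         beyond ¬in-a′ (es c a′ , vs c b′ , in-b′ , joins-sym J′))
      where
      J : Joins G (es c a) (vs c a) (vs c b)
      J = cycle-joins c a→b
      J′ : Joins G (es c a′) (vs c a′) (vs c b′)
      J′ = cycle-joins c a′→b′
      in-b′ : In b′
      in-b′ = decidable-stable (In? b′) ¬¬in-b′
      distinct : es c a ≢ es c a′
      distinct eq with refl ← es-inj c eq = ¬in-a′ in-a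

  FVC-─ : ∀ {C F} X → FVC G ⊤ C F → FVC G (⊤ ─ X) (C ─ X) (F ─ X)
  FVC-─ {C} {F} X (_ , _ , disjoint , F-acyclic , trees) =
    ─-monoˡ ⊆⊤ , ─-monoˡ ⊆⊤ , disjoint′ , Acyclic-anti (p─q⊆p F X) F-acyclic , trees′
    where
    disjoint′ : Disjoint (C ─ X) (F ─ X)
    disjoint′ (x , x∈) = let (x∈C─X , x∈F─X) = x∈p∩q⁻ (C ─ X) (F ─ X) x∈ in
      disjoint (x , x∈p∩q⁺ (p─q⊆p C X x∈C─X , p─q⊆p F X x∈F─X))

    rest⊆ : (⊤ ─ X) ─ ((C ─ X) ∪ (F ─ X)) ⊆ ⊤ ─ (C ∪ F)
    rest⊆ y∈ = x∈p∧x∉q⇒x∈p─q ∈⊤ λ y∈C∪F →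
      x∈p─q⇒x∉q _ _ y∈ (x∈p∪q─r C F X y∈C∪F (x∈p─q⇒x∉q ⊤ X (p─q⊆p _ _ y∈)))

    trees′ : ∀ T → IsTreeOf G (F ─ X) T → e G T ((⊤ ─ X) ─ ((C ─ X) ∪ (F ─ X))) ≤ 1
    trees′ T ((t , t∈T) , T⊆F─X , connected , _) =
      ≤-trans (e-mono T⊆component rest⊆) (trees component component-isTree)
      where
      T⊆F : T ⊆ F
      T⊆F x∈T = p─q⊆p F X (T⊆F─X x∈T)
      open Component F (T⊆F t∈T)
      T⊆component : T ⊆ component
      T⊆component u∈T = closed-walk component-closed T⊆F (connected _ _ t∈T u∈T) t∈component

  antler-minimum : ∀ {U C F} → Antler G U C F → ∀ S → IsFVS G (C ∪ F) S → ∣ C ∣ ≤ ∣ S ∣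
  antler-minimum (_ , _ , (_ , minimal) , ∣C∣≤k) S S-fvs = ≤-trans ∣C∣≤k (minimal S S-fvs)

  antler-intro : ∀ {U C F} → FVC G U C F → (∀ S → IsFVS G (C ∪ F) S → ∣ C ∣ ≤ ∣ S ∣) →
                 Antler G U C F
  antler-intro {C = C} {F} fvc@(_ , _ , _ , F-acyclic , _) minimal =
    fvc , ∣ C ∣ , ((C , (p⊆p∪q F , Acyclic-anti (p∪q─p⊆q C F) F-acyclic) , refl) , minimal) , ≤-refl

  exchange-isFVS : ∀ {C₁ F₁ C₂ F₂} → FVC G ⊤ C₁ F₁ → Acyclic G F₂ →
                   IsFVS G (C₂ ∪ F₂) ((C₂ ─ F₁) ∪ (C₁ ∩ F₂))
  exchange-isFVS {C₁} {F₁} {C₂} {F₂} fvc₁@(_ , _ , disjoint₁ , _) F₂-acyclic =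
    Y⊆ , λ c → F₂-acyclic (retarget c (in-F₂ c))
    where
    Y : VSet G
    Y = (C₂ ─ F₁) ∪ (C₁ ∩ F₂)

    Y⊆ : Y ⊆ C₂ ∪ F₂
    Y⊆ y∈ = [ p⊆p∪q F₂ ∘ p─q⊆p C₂ F₁ , q⊆p∪q C₂ F₂ ∘ proj₂ ∘ x∈p∩q⁻ C₁ F₂ ] (x∈p∪q⁻ _ _ y∈)

    ∉C₁ : ∀ {v} → v ∈ C₂ ∪ F₂ → v ∉ Y → v ∉ C₁
    ∉C₁ {v} v∈ v∉Y v∈C₁ = v∉Y (x∈p∪q⁺ (Data.Sum.map
      (λ v∈C₂ → x∈p∧x∉q⇒x∈p─q v∈C₂ λ v∈F₁ → disjoint₁ (v , x∈p∩q⁺ (v∈C₁ , v∈F₁)))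
      (λ v∈F₂ → x∈p∩q⁺ (v∈C₁ , v∈F₂)) (x∈p∪q⁻ C₂ F₂ v∈)))

    ∈F₂ : ∀ {v} → v ∈ C₂ ∪ F₂ → v ∉ Y → v ∉ F₁ → v ∈ F₂
    ∈F₂ v∈ v∉Y v∉F₁ = [ (λ v∈C₂ → ⊥-elim (v∉Y (p⊆p∪q _ (x∈p∧x∉q⇒x∈p─q v∈C₂ v∉F₁))))
                       , (λ v∈F₂ → v∈F₂) ] (x∈p∪q⁻ C₂ F₂ v∈)

    in-F₂ : (c : Cycle G ((C₂ ∪ F₂) ─ Y)) → ∀ i → vs c i ∈ F₂
    in-F₂ c i = ∈F₂ (in₂ i) (out i) (cycle-∉C⇒∉F fvc₁ c (λ j → ∉C₁ (in₂ j) (out j)) i)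
      where
      in₂ : ∀ i → vs c i ∈ C₂ ∪ F₂
      in₂ i = p─q⊆p _ _ (vs-in c i)
      out : ∀ i → vs c i ∉ Y
      out i = x∈p─q⇒x∉q _ _ (vs-in c i)

  ∣C₂∩F₁∣≤∣C₁∩F₂∣ : ∀ {C₁ F₁ C₂ F₂} → FVC G ⊤ C₁ F₁ → Antler G ⊤ C₂ F₂ →
                    ∣ C₂ ∩ F₁ ∣ ≤ ∣ C₁ ∩ F₂ ∣
  ∣C₂∩F₁∣≤∣C₁∩F₂∣ {C₁} {F₁} {C₂} {F₂} fvc₁ A₂@((_ , _ , _ , F₂-acyclic , _) , _) =
    +-cancelˡ-≤ ∣ C₂ ─ F₁ ∣ _ _ (begin
      ∣ C₂ ─ F₁ ∣ + ∣ C₂ ∩ F₁ ∣ ≡⟨ ∣p∣≡∣p─q∣+∣p∩q∣ C₂ F₁ ⟨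
      ∣ C₂ ∣                    ≤⟨ antler-minimum A₂ _ (exchange-isFVS fvc₁ F₂-acyclic) ⟩
      ∣ (C₂ ─ F₁) ∪ (C₁ ∩ F₂) ∣ ≤⟨ ∣p∪q∣≤∣p∣+∣q∣ (C₂ ─ F₁) (C₁ ∩ F₂) ⟩
      ∣ C₂ ─ F₁ ∣ + ∣ C₁ ∩ F₂ ∣ ∎)
    where open ≤-Reasoning

  extend-isFVS : ∀ {C₁ F₁ C₂ F₂ S} → FVC G ⊤ C₂ F₂ →
                 IsFVS G ((C₁ ─ (C₂ ∪ F₂)) ∪ (F₁ ─ (C₂ ∪ F₂))) S →
                 IsFVS G (C₁ ∪ F₁) (S ∪ ((C₁ ∩ C₂) ∪ (C₂ ∩ F₁)))
  extend-isFVS {C₁} {F₁} {C₂} {F₂} {S} fvc₂ (S⊆ , S-acyclic) =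
    S′⊆ , λ c → S-acyclic (retarget c (in-rest c))
    where
    X Z : VSet G
    X = C₂ ∪ F₂
    Z = (C₁ ∩ C₂) ∪ (C₂ ∩ F₁)

    S′⊆ : S ∪ Z ⊆ C₁ ∪ F₁
    S′⊆ x∈ = [ p─r∪q─r⊆p∪q C₁ F₁ X ∘ S⊆
             , [ p⊆p∪q F₁ ∘ proj₁ ∘ x∈p∩q⁻ C₁ C₂ , q⊆p∪q C₁ F₁ ∘ proj₂ ∘ x∈p∩q⁻ C₂ F₁ ] ∘ x∈p∪q⁻ _ _
             ] (x∈p∪q⁻ S Z x∈)

    ∉C₂ : ∀ {v} → v ∈ C₁ ∪ F₁ → v ∉ S ∪ Z → v ∉ C₂
    ∉C₂ v∈ v∉S′ v∈C₂ = v∉S′ (q⊆p∪q S Z (x∈p∪q⁺ (Data.Sum.map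
      (λ v∈C₁ → x∈p∩q⁺ (v∈C₁ , v∈C₂)) (λ v∈F₁ → x∈p∩q⁺ (v∈C₂ , v∈F₁)) (x∈p∪q⁻ C₁ F₁ v∈))))

    in-rest : (c : Cycle G ((C₁ ∪ F₁) ─ (S ∪ Z))) → ∀ i → vs c i ∈ ((C₁ ─ X) ∪ (F₁ ─ X)) ─ S
    in-rest c i = x∈p∧x∉q⇒x∈p─q (x∈p∪q─r C₁ F₁ X (in₁ i) ∉X) (out i ∘ p⊆p∪q Z)
      where
      in₁ : ∀ i → vs c i ∈ C₁ ∪ F₁
      in₁ i = p─q⊆p _ _ (vs-in c i)
      out : ∀ i → vs c i ∉ S ∪ Z
      out i = x∈p─q⇒x∉q _ _ (vs-in c i)
      ∉X : vs c i ∉ X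
      ∉X v∈X = [ ∉C₂ (in₁ i) (out i) , cycle-∉C⇒∉F fvc₂ c (λ j → ∉C₂ (in₁ j) (out j)) i ]
                 (x∈p∪q⁻ C₂ F₂ v∈X)

  antler-─-minimum : ∀ {C₁ F₁ C₂ F₂ S} → Antler G ⊤ C₁ F₁ → Antler G ⊤ C₂ F₂ →
               IsFVS G ((C₁ ─ (C₂ ∪ F₂)) ∪ (F₁ ─ (C₂ ∪ F₂))) S → ∣ C₁ ─ (C₂ ∪ F₂) ∣ ≤ ∣ S ∣
  antler-─-minimum {C₁} {F₁} {C₂} {F₂} {S} A₁@(fvc₁ , _) A₂@(fvc₂@(_ , _ , disjoint₂ , _) , _) S-fvs =
    +-cancelʳ-≤ a _ _ (+-cancelʳ-≤ b _ _ (begin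
      ∣ C ∣ + a + b   ≡⟨ ∣C₁∣≡∣C∣+a+b ⟨
      ∣ C₁ ∣          ≤⟨ antler-minimum A₁ _ (extend-isFVS fvc₂ S-fvs) ⟩
      ∣ S ∪ Z ∣       ≤⟨ ∣p∪q∣≤∣p∣+∣q∣ S Z ⟩
      ∣ S ∣ + ∣ Z ∣    ≤⟨ +-monoʳ-≤ ∣ S ∣ ∣Z∣≤b+a ⟩
      ∣ S ∣ + (b + a) ≡⟨ cong (∣ S ∣ +_) (+-comm b a) ⟩
      ∣ S ∣ + (a + b) ≡⟨ +-assoc ∣ S ∣ a b ⟨
      ∣ S ∣ + a + b   ∎))
    where
    open ≤-Reasoning
    C Z : VSet G
    C = C₁ ─ (C₂ ∪ F₂)
    Z = (C₁ ∩ C₂) ∪ (C₂ ∩ F₁)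
    a b : ℕ
    a = ∣ (C₁ ─ C₂) ∩ F₂ ∣
    b = ∣ C₁ ∩ C₂ ∣

    ∣C₁∣≡∣C∣+a+b : ∣ C₁ ∣ ≡ ∣ C ∣ + a + b
    ∣C₁∣≡∣C∣+a+b = trans (∣p∣≡∣p─q∣+∣p∩q∣ C₁ C₂) (cong (_+ b)
      (trans (∣p∣≡∣p─q∣+∣p∩q∣ (C₁ ─ C₂) F₂) (cong (λ D → ∣ D ∣ + a) (p─q─r≡p─q∪r C₁ C₂ F₂))))

    C₁∩F₂⊆ : C₁ ∩ F₂ ⊆ (C₁ ─ C₂) ∩ F₂
    C₁∩F₂⊆ {x} x∈ = let (x∈C₁ , x∈F₂) = x∈p∩q⁻ C₁ F₂ x∈ in
      x∈p∩q⁺ (x∈p∧x∉q⇒x∈p─q x∈C₁ (λ x∈C₂ → disjoint₂ (x , x∈p∩q⁺ (x∈C₂ , x∈F₂))) , x∈F₂)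

    ∣Z∣≤b+a : ∣ Z ∣ ≤ b + a
    ∣Z∣≤b+a = ≤-trans (∣p∪q∣≤∣p∣+∣q∣ (C₁ ∩ C₂) (C₂ ∩ F₁))
      (+-monoʳ-≤ b (≤-trans (∣C₂∩F₁∣≤∣C₁∩F₂∣ fvc₁ A₂) (p⊆q⇒∣p∣≤∣q∣ C₁∩F₂⊆)))

proposition11 : (G : Multigraph) (C₁ F₁ C₂ F₂ : VSet G) →
    Antler G ⊤ C₁ F₁ → Antler G ⊤ C₂ F₂ →
    Antler G (⊤ ─ (C₂ ∪ F₂)) (C₁ ─ (C₂ ∪ F₂)) (F₁ ─ (C₂ ∪ F₂))
proposition11 G C₁ F₁ C₂ F₂ A₁ A₂ =
  antler-intro G (FVC-─ G (C₂ ∪ F₂) (proj₁ A₁)) (λ S → antler-─-minimum G A₁ A₂)
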